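{- Let $\mathbb{S}$ be the set of steps over a g-comtrace alphabet $(E,sim,ser,inl)$, let $u,v\in\mathbb{S}^*$, $a\in E$ and $D\subseteq E$. Then: (1) $u\equiv v\Rightarrow\mathrm{weight}(u)=\mathrm{weight}(v)$; (2) $u\equiv v\Rightarrow|u|_a=|v|_a$; (3) $u\equiv v\Rightarrow u\div_R a\equiv v\div_R a$; (4) $u\equiv v\Rightarrow u\div_L a\equiv v\div_L a$; (5) $u\equiv v\iff\forall s,t\in\mathbb{S}^*.\ sut\equiv svt$; (6) $u\equiv v\Rightarrow\pi_D(u)\equiv\pi_D(v)$.
   Context: A g-comtrace alphabet is $(E,sim,ser,inl)$ with $E$ finite, $sim,inl\subseteq E\times E$ irreflexive and symmetric, $ser\subseteq sim$, $sim\cap inl=\emptyset$. Steps $\mathbb{S}$: nonempty $A\subseteq E$ with $(a,b)\in sim$ for all distinct $a,b\in A$; $\lambda$ is the empty step sequence. The g-comtrace congruence $\equiv$ on $\mathbb{S}^*$ is the reflexive symmetric transitive closure of pairs $(wAz,wBCz)$ ($A,B,C\in\mathbb{S}$, $A=B\cup C$, $B\times C\subseteq ser$) and $(wABz,wBAz)$ ($A,B\in\mathbb{S}$, $A\times B\subseteq inl$). For $x=X_1\dots X_k$: $\mathrm{weight}(x)=\sum_i|X_i|$; $|x|_a$ is the number of $i$ with $a\in X_i$. Right cancellation: $\lambda\div_R a=\lambda$; $wA\div_R a=(w\div_R a)A$ if $a\notin A$, $=w$ if $A=\{a\}$, $=w(A\setminus\{a\})$ otherwise. Left cancellation: $\lambda\div_L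 a=\lambda$; $Aw\div_L a=A(w\div_L a)$ if $a\notin A$, $=w$ if $A=\{a\}$, $=(A\setminus\{a\})w$ otherwise. Projection: $\pi_D(\lambda)=\lambda$; $\pi_D(wA)=\pi_D(w)$ if $A\cap D=\emptyset$, otherwise $\pi_D(w)(A\cap D)$. -}

module Defs where

open import Level using (0ℓ)
open import Data.Nat using (ℕ; zero; suc; _+_)
open import Data.Bool using (Bool)
import Data.Bool as B
open import Data.Fin using (Fin)
open import Data.Fin.Subset using (Subset; _∈_; _∉_; _∩_; _∪_; _─_; ⁅_⁆; ∣_∣; Nonempty; Empty; ⊥)
open import Data.Fin.Subset.Properties using (_∈?_)
open import Data.Vec.Properties using (≡-dec)
open import Data.List using (List; []; _∷_; _++_; [_])
open import Data.List.Relation.Unary.All using (All)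
open import Data.List.Reverse using (Reverse; []; _∶_∶ʳ_; reverseView)
open import Data.Product using (_×_)
open import Relation.Binary.Core using (Rel)
open import Relation.Binary.PropositionalEquality using (_≡_; _≢_)
open import Relation.Nullary using (¬_; Dec; yes; no)

record GComtraceAlphabet (n : ℕ) : Set₁ where
  field
    sim ser inl : Rel (Fin n) 0ℓ
    sim-irrefl  : ∀ a → ¬ sim a a
    sim-sym     : ∀ a b → sim a b → sim b a
    inl-irrefl  : ∀ a → ¬ inl a a
    inl-sym     : ∀ a b → inl a b → inl b a
    ser⊆sim     : ∀ a b → ser a b → sim a b
    sim∩inl=∅   : ∀ a b → sim a b → ¬ inl a b

module _ {n : ℕ} (Σ : GComtraceAlphabet n) where
  open GComtraceAlphabet Σ

  IsStep : Subset n → Set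
  IsStep A = Nonempty A × (∀ a b → a ∈ A → b ∈ A → a ≢ b → sim a b)

  IsStepSeq : List (Subset n) → Set
  IsStepSeq = All IsStep

  data Gen : List (Subset n) → List (Subset n) → Set where
    ser-split : ∀ w z A B C → IsStepSeq w → IsStepSeq z →
                IsStep A → IsStep B → IsStep C →
                A ≡ B ∪ C → (∀ b c → b ∈ B → c ∈ C → ser b c) →
                Gen (w ++ A ∷ z) (w ++ B ∷ C ∷ z)
    inl-swap  : ∀ w z A B → IsStepSeq w → IsStepSeq z →
                IsStep A → IsStep B →
                (∀ a b → a ∈ A → b ∈ B → inl a b) →
                Gen (w ++ A ∷ B ∷ z) (w ++ B ∷ A ∷ z)

  data _≡gc_ : List (Subset n) → List (Subset n) → Set where
    gc-refl  : ∀ {x} → x ≡gc x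
    gc-sym   : ∀ {x y} → x ≡gc y → y ≡gc x
    gc-trans : ∀ {x y z} → x ≡gc y → y ≡gc z → x ≡gc z
    gc-gen   : ∀ {x y} → Gen x y → x ≡gc y

weight : ∀ {n} → List (Subset n) → ℕ
weight []       = 0
weight (X ∷ xs) = ∣ X ∣ + weight xs

occ : ∀ {n} → List (Subset n) → Fin n → ℕ
occ []       a = 0
occ (X ∷ xs) a with a ∈? X
... | yes _ = suc (occ xs a)
... | no  _ = occ xs a

subset-≟ : ∀ {n} (A B : Subset n) → Dec (A ≡ B)
subset-≟ = ≡-dec B._≟_

divR-view : ∀ {n} {x : List (Subset n)} → Reverse x → Fin n → List (Subset n)
divR-view [] a = []
divR-view (w ∶ r ∶ʳ A) a with a ∈? A
... | no _ = divR-view r a ++ [ A ]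
... | yes _ with subset-≟ A ⁅ a ⁆
...   | yes _ = w
...   | no  _ = w ++ [ A ─ ⁅ a ⁆ ]

_÷R_ : ∀ {n} → List (Subset n) → Fin n → List (Subset n)
x ÷R a = divR-view (reverseView x) a

_÷L_ : ∀ {n} → List (Subset n) → Fin n → List (Subset n)
[] ÷L a = []
(A ∷ w) ÷L a with a ∈? A
... | no _ = A ∷ (w ÷L a)
... | yes _ with subset-≟ A ⁅ a ⁆
...   | yes _ = w
...   | no  _ = (A ─ ⁅ a ⁆) ∷ w

proj-view : ∀ {n} {x : List (Subset n)} → Subset n → Reverse x → List (Subset n)
proj-view D [] = []
proj-view D (w ∶ r ∶ʳ A) with subset-≟ (A ∩ D) ⊥
... | yes _ = proj-view D r
... | no  _ = proj-view D r ++ [ A ∩ D ]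

π : ∀ {n} → Subset n → List (Subset n) → List (Subset n)
π D x = proj-view D (reverseView x)

module Submission where

-- Every generating pair of the g-comtrace congruence ≡ has the form
-- (w L z , w R z) for a "window" (L , R) = ([B ∪ C] , [B , C]) with
-- B × C ⊆ ser, or (L , R) = ([A , B] , [B , A]) with A × B ⊆ inl.  As ≡ is
-- the least equivalence containing these pairs, a map preserves ≡ (or is
-- constant on classes) once it does so on windows in context.
--   (5) Windows in context remain windows in any larger context.
--   (1) |B ∪ C| = |B| + |C|, since ser ⊆ sim is irreflexive.
--   (6) Restricting a window to D yields a window or two equal sequences.
--   (2) follows from (1) and (6), because |x|_a = weight (π_{a} x).
--   (3),(4) Cancelling a acts before, inside or after the window; inside it,
--   a occurs at most once, so cancelling a is projecting onto E ∖ {a} and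
--   (6) applies.

open import Defs
open import Data.Nat using (ℕ; suc; _+_)
open import Data.Nat.Properties using (+-assoc; +-suc; +-commutativeSemigroup)
open import Algebra.Properties.CommutativeSemigroup +-commutativeSemigroup using (x∙yz≈y∙xz)
open import Data.Empty using (⊥-elim)
open import Data.Fin using (Fin)
import Data.Fin as Fin
open import Data.Fin.Subset using (Subset; inside; outside; _∈_; _∉_; _⊆_; _∩_; _∪_; _─_; ∁; ⁅_⁆; ∣_∣; Nonempty; ⊥)
open import Data.Fin.Subset.Properties
  using (_∈?_; ⊆-antisym; nonempty?; Empty-unique; ∉⊥; ⊥⊆; ∣⊥∣≡0; x∈⁅x⁆; x∈⁅y⁆⇒x≡y; ∣⁅x⁆∣≡1;
         x∉p⇒x∈∁p; p∩q⊆p; p∩q⊆q; p─q⊆p; x∈p∩q⁺; x∈p∩q⁻; x∈p∪q⁺; x∈p∪q⁻; p⊆p∪q;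
         ∩-inverseʳ; ∩-distribʳ-∪; ∪-identityˡ; ∪-identityʳ)
open import Data.Vec using (_∷_; []; here; there)
open import Data.List using (List; []; _∷_; _++_; [_])
open import Data.List.Properties using (++-assoc; ++-identityʳ)
open import Data.List.Relation.Unary.All using (_∷_; [])
import Data.List.Relation.Unary.All.Properties as All
open import Data.List.Relation.Unary.Any using (Any; here; there; any?)
import Data.List.Relation.Unary.Any.Properties as Any
open import Data.List.Reverse using (Reverse; []; _∶_∶ʳ_; reverseView)
open import Data.Product using (_×_; _,_; proj₁; map₂)
open import Data.Sum using (inj₁; inj₂; [_,_]′)
open import Function using (_on_)
open import Function.Bundles using (_⇔_; mk⇔; Equivalence)
open import Relation.Binary using (Rel; IsEquivalence)
import Relation.Binary.Construct.On as On
open import Relation.Binary.PropositionalEquality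
  using (_≡_; _≢_; refl; sym; trans; cong; cong₂; subst; isEquivalence)
open import Relation.Nullary using (¬_; Dec; yes; no)

private
  variable
    n : ℕ
    a : Fin n
    A B C D X Y : Subset n
    s t u v w x y z L R : List (Subset n)

Disjoint : Subset n → Subset n → Set
Disjoint B C = ∀ {x} → x ∈ B → x ∉ C

∣∪∣-disjoint : (B C : Subset n) → Disjoint B C → ∣ B ∪ C ∣ ≡ ∣ B ∣ + ∣ C ∣
∣∪∣-disjoint [] [] _ = refl
∣∪∣-disjoint (inside ∷ B) (inside ∷ C) d = ⊥-elim (d here here)
∣∪∣-disjoint (inside ∷ B) (outside ∷ C) d = cong suc (∣∪∣-disjoint B C (λ b c → d (there b) (there c)))
∣∪∣-disjoint (outside ∷ B) (inside ∷ C) d =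
  trans (cong suc (∣∪∣-disjoint B C (λ b c → d (there b) (there c)))) (sym (+-suc ∣ B ∣ ∣ C ∣))
∣∪∣-disjoint (outside ∷ B) (outside ∷ C) d = ∣∪∣-disjoint B C (λ b c → d (there b) (there c))

nonempty⇒≢⊥ : Nonempty X → X ≢ ⊥
nonempty⇒≢⊥ (x , x∈X) X≡⊥ = ∉⊥ (subst (x ∈_) X≡⊥ x∈X)

≢⊥⇒nonempty : X ≢ ⊥ → Nonempty X
≢⊥⇒nonempty {X = X} X≢⊥ with nonempty? X
... | yes ne = ne
... | no empty = ⊥-elim (X≢⊥ (Empty-unique empty))

⊆-≢⊥ : X ⊆ Y → X ≢ ⊥ → Y ≢ ⊥
⊆-≢⊥ X⊆Y X≢⊥ = nonempty⇒≢⊥ (map₂ X⊆Y (≢⊥⇒nonempty X≢⊥))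

∪-mono-⊆ : X ⊆ B → Y ⊆ C → X ∪ Y ⊆ B ∪ C
∪-mono-⊆ {X = X} {Y = Y} X⊆B Y⊆C h with x∈p∪q⁻ X Y h
... | inj₁ x∈X = x∈p∪q⁺ (inj₁ (X⊆B x∈X))
... | inj₂ x∈Y = x∈p∪q⁺ (inj₂ (Y⊆C x∈Y))

-- Set difference is intersection with the complement (the cancellations of
-- Defs use ─, projections use ∩).
─≡∩∁ : (p q : Subset n) → p ─ q ≡ p ∩ ∁ q
─≡∩∁ [] [] = refl
─≡∩∁ (inside ∷ p) (inside ∷ q) = cong (outside ∷_) (─≡∩∁ p q)
─≡∩∁ (outside ∷ p) (inside ∷ q) = cong (outside ∷_) (─≡∩∁ p q)
─≡∩∁ (inside ∷ p) (outside ∷ q) = cong (inside ∷_) (─≡∩∁ p q)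
─≡∩∁ (outside ∷ p) (outside ∷ q) = cong (outside ∷_) (─≡∩∁ p q)

∩∁⁅⁆-absent : a ∉ A → A ∩ ∁ ⁅ a ⁆ ≡ A
∩∁⁅⁆-absent {a = a} {A = A} a∉A = ⊆-antisym (p∩q⊆p A _) keep
  where
  keep : A ⊆ A ∩ ∁ ⁅ a ⁆
  keep x∈A = x∈p∩q⁺ (x∈A , x∉p⇒x∈∁p (λ x∈⁅a⁆ → a∉A (subst (_∈ A) (x∈⁅y⁆⇒x≡y a x∈⁅a⁆) x∈A)))

∩∁⁅⁆-nonempty : a ∈ A → A ≢ ⁅ a ⁆ → A ∩ ∁ ⁅ a ⁆ ≢ ⊥
∩∁⁅⁆-nonempty {a = a} {A = A} a∈A A≢⁅a⁆ rest≡⊥ = A≢⁅a⁆ (⊆-antisym only-a has-a)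
  where
  only-a : A ⊆ ⁅ a ⁆
  only-a {x} x∈A with x Fin.≟ a
  ... | yes refl = x∈⁅x⁆ a
  ... | no x≢a = ⊥-elim (∉⊥ (subst (x ∈_) rest≡⊥ (x∈p∩q⁺ (x∈A , x∉p⇒x∈∁p (λ h → x≢a (x∈⁅y⁆⇒x≡y a h))))))
  has-a : ⁅ a ⁆ ⊆ A
  has-a x∈⁅a⁆ = subst (_∈ A) (sym (x∈⁅y⁆⇒x≡y a x∈⁅a⁆)) a∈A

∣∩⁅⁆∣-present : a ∈ X → ∣ X ∩ ⁅ a ⁆ ∣ ≡ 1
∣∩⁅⁆∣-present {a = a} {X = X} a∈X = trans (cong ∣_∣ (⊆-antisym (p∩q⊆q X _) only)) (∣⁅x⁆∣≡1 a)
  where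
  only : ⁅ a ⁆ ⊆ X ∩ ⁅ a ⁆
  only h = x∈p∩q⁺ (subst (_∈ X) (sym (x∈⁅y⁆⇒x≡y a h)) a∈X , h)

∣∩⁅⁆∣-absent : ∀ {n} {a : Fin n} {X : Subset n} → a ∉ X → ∣ X ∩ ⁅ a ⁆ ∣ ≡ 0
∣∩⁅⁆∣-absent {n} {a} {X} a∉X = trans (cong ∣_∣ (⊆-antisym none ⊥⊆)) (∣⊥∣≡0 n)
  where
  none : X ∩ ⁅ a ⁆ ⊆ ⊥
  none h with x∈p∩q⁻ X ⁅ a ⁆ h
  ... | x∈X , x∈⁅a⁆ = ⊥-elim (a∉X (subst (_∈ X) (x∈⁅y⁆⇒x≡y a x∈⁅a⁆) x∈X))

weight-++ : (x y : List (Subset n)) → weight (x ++ y) ≡ weight x + weight y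
weight-++ [] y = refl
weight-++ (X ∷ x) y = trans (cong (∣ X ∣ +_) (weight-++ x y)) (sym (+-assoc ∣ X ∣ (weight x) (weight y)))

-- Projection, computed by structural recursion

prepend : Subset n → List (Subset n) → List (Subset n)
prepend Y t with subset-≟ Y ⊥
... | yes _ = t
... | no _ = Y ∷ t

-- π′ D x equals π D x (see π≡π′) but recurses from the left.
π′ : Subset n → List (Subset n) → List (Subset n)
π′ D [] = []
π′ D (A ∷ x) = prepend (A ∩ D) (π′ D x)

prepend-⊥ : Y ≡ ⊥ → prepend Y t ≡ t
prepend-⊥ {Y = Y} Y≡⊥ with subset-≟ Y ⊥
... | yes _ = refl
... | no Y≢⊥ = ⊥-elim (Y≢⊥ Y≡⊥)

prepend-≢⊥ : Y ≢ ⊥ → prepend Y t ≡ Y ∷ t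
prepend-≢⊥ {Y = Y} Y≢⊥ with subset-≟ Y ⊥
... | yes Y≡⊥ = ⊥-elim (Y≢⊥ Y≡⊥)
... | no _ = refl

prepend-++ : (Y : Subset n) (x y : List (Subset n)) → prepend Y x ++ y ≡ prepend Y (x ++ y)
prepend-++ Y x y with subset-≟ Y ⊥
... | yes _ = refl
... | no _ = refl

-- Empty steps weigh nothing, so prepending adds the size of Y in all cases.
weight-prepend : ∀ {n} (Y : Subset n) t → weight (prepend Y t) ≡ ∣ Y ∣ + weight t
weight-prepend {n} Y t with subset-≟ Y ⊥
... | yes refl = cong (_+ weight t) (sym (∣⊥∣≡0 n))
... | no _ = refl

π′-++ : (D : Subset n) (x y : List (Subset n)) → π′ D (x ++ y) ≡ π′ D x ++ π′ D y
π′-++ D [] y = refl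
π′-++ D (A ∷ x) y = trans (cong (prepend (A ∩ D)) (π′-++ D x y)) (sym (prepend-++ (A ∩ D) (π′ D x) (π′ D y)))

π-snoc : ∀ (D : Subset n) {x} (r : Reverse x) A → proj-view D (x ∶ r ∶ʳ A) ≡ proj-view D r ++ π′ D [ A ]
π-snoc D r A with subset-≟ (A ∩ D) ⊥
... | yes _ = sym (++-identityʳ _)
... | no _ = refl

π≡π′ : ∀ (D : Subset n) {x} (r : Reverse x) → proj-view D r ≡ π′ D x
π≡π′ D [] = refl
π≡π′ D (x ∶ r ∶ʳ A) = trans (π-snoc D r A) (trans (cong (_++ π′ D [ A ]) (π≡π′ D r)) (sym (π′-++ D x [ A ])))

occ≡weight∘π′ : (x : List (Subset n)) (a : Fin n) → occ x a ≡ weight (π′ ⁅ a ⁆ x)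
occ≡weight∘π′ [] a = refl
occ≡weight∘π′ (X ∷ x) a with a ∈? X
... | yes a∈X = sym (trans (weight-prepend (X ∩ ⁅ a ⁆) _)
                  (cong₂ _+_ (∣∩⁅⁆∣-present a∈X) (sym (occ≡weight∘π′ x a))))
... | no a∉X = sym (trans (weight-prepend (X ∩ ⁅ a ⁆) _)
                  (cong₂ _+_ (∣∩⁅⁆∣-absent a∉X) (sym (occ≡weight∘π′ x a))))

-- Cancellation, computed by structural recursion

Occurs : Fin n → List (Subset n) → Set
Occurs a = Any (a ∈_)

occurs? : (a : Fin n) (x : List (Subset n)) → Dec (Occurs a x)
occurs? a = any? (a ∈?_)

¬Occurs-[] : ¬ Occurs a []
¬Occurs-[] ()

¬Occurs-∷ : a ∉ A → ¬ Occurs a t → ¬ Occurs a (A ∷ t)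
¬Occurs-∷ a∉A _ (here a∈A) = a∉A a∈A
¬Occurs-∷ _ ¬occ (there occ) = ¬occ occ

¬Occurs-++ : ∀ x → ¬ Occurs a x → ¬ Occurs a t → ¬ Occurs a (x ++ t)
¬Occurs-++ x ¬occ-x ¬occ-t occ with Any.++⁻ x occ
... | inj₁ occ-x = ¬occ-x occ-x
... | inj₂ occ-t = ¬occ-t occ-t

cancel : Subset n → Fin n → List (Subset n)
cancel A a = [ A ] ÷L a

÷L-pass : ∀ w → a ∉ A → (A ∷ w) ÷L a ≡ A ∷ (w ÷L a)
÷L-pass {a = a} {A = A} w a∉A with a ∈? A
... | yes a∈A = ⊥-elim (a∉A a∈A)
... | no _ = refl

÷L-head : ∀ w → a ∈ A → (A ∷ w) ÷L a ≡ cancel A a ++ w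
÷L-head {a = a} {A = A} w a∈A with a ∈? A
... | no a∉A = ⊥-elim (a∉A a∈A)
... | yes _ with subset-≟ A ⁅ a ⁆
...   | yes _ = refl
...   | no _ = refl

cancel-absent : a ∉ A → cancel A a ≡ [ A ]
cancel-absent = ÷L-pass []

÷L-skip : ∀ w x → ¬ Occurs a w → (w ++ x) ÷L a ≡ w ++ (x ÷L a)
÷L-skip [] x _ = refl
÷L-skip (A ∷ w) x ¬occ =
  trans (÷L-pass (w ++ x) (λ a∈A → ¬occ (here a∈A))) (cong (A ∷_) (÷L-skip w x (λ occ → ¬occ (there occ))))

÷L-within : ∀ w x → Occurs a w → (w ++ x) ÷L a ≡ (w ÷L a) ++ x
÷L-within {a = a} (A ∷ w) x occ = by-head (a ∈? A) occ
  where
  by-head : Dec (a ∈ A) → Occurs a (A ∷ w) → ((A ∷ w) ++ x) ÷L a ≡ ((A ∷ w) ÷L a) ++ x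
  by-head (yes a∈A) _ =
    trans (÷L-head (w ++ x) a∈A) (trans (sym (++-assoc (cancel A a) w x)) (cong (_++ x) (sym (÷L-head w a∈A))))
  by-head (no a∉A) (here a∈A) = ⊥-elim (a∉A a∈A)
  by-head (no a∉A) (there occ) =
    trans (÷L-pass (w ++ x) a∉A) (trans (cong (A ∷_) (÷L-within w x occ)) (cong (_++ x) (sym (÷L-pass w a∉A))))

-- Right cancellation, recursing from the left: A stays unless it is the
-- last step containing a.
cancelLast : List (Subset n) → Fin n → List (Subset n)
cancelLast [] a = []
cancelLast (A ∷ w) a with occurs? a w
... | yes _ = A ∷ cancelLast w a
... | no _ = cancel A a ++ w

cancelLast-occ : Occurs a w → cancelLast (A ∷ w) a ≡ A ∷ cancelLast w a
cancelLast-occ {a = a} {w = w} occ with occurs? a w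
... | yes _ = refl
... | no ¬occ = ⊥-elim (¬occ occ)

cancelLast-last : ¬ Occurs a w → cancelLast (A ∷ w) a ≡ cancel A a ++ w
cancelLast-last {a = a} {w = w} ¬occ with occurs? a w
... | yes occ = ⊥-elim (¬occ occ)
... | no _ = refl

cancelLast-absent : ∀ x → ¬ Occurs a x → cancelLast x a ≡ x
cancelLast-absent [] _ = refl
cancelLast-absent (A ∷ x) ¬occ =
  trans (cancelLast-last (λ occ → ¬occ (there occ))) (cong (_++ x) (cancel-absent (λ a∈A → ¬occ (here a∈A))))

cancelLast-within : ∀ w x → Occurs a x → cancelLast (w ++ x) a ≡ w ++ cancelLast x a
cancelLast-within [] x _ = refl
cancelLast-within (A ∷ w) x occ = trans (cancelLast-occ (Any.++⁺ʳ w occ)) (cong (A ∷_) (cancelLast-within w x occ))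

cancelLast-skip : ∀ w x → ¬ Occurs a x → cancelLast (w ++ x) a ≡ cancelLast w a ++ x
cancelLast-skip [] x ¬occ = cancelLast-absent x ¬occ
cancelLast-skip {a = a} (A ∷ w) x ¬occ-x with occurs? a w
... | yes occ-w = trans (cancelLast-occ (Any.++⁺ˡ occ-w)) (cong (A ∷_) (cancelLast-skip w x ¬occ-x))
... | no ¬occ-w = trans (cancelLast-last (¬Occurs-++ w ¬occ-w ¬occ-x)) (sym (++-assoc (cancel A a) w x))

÷R-snoc-absent : ∀ {x} (r : Reverse x) → a ∉ A → divR-view (x ∶ r ∶ʳ A) a ≡ divR-view r a ++ [ A ]
÷R-snoc-absent {a = a} {A = A} r a∉A with a ∈? A
... | yes a∈A = ⊥-elim (a∉A a∈A)
... | no _ = refl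

÷R-snoc-present : ∀ {x} (r : Reverse x) → a ∈ A → divR-view (x ∶ r ∶ʳ A) a ≡ x ++ cancel A a
÷R-snoc-present {a = a} {A = A} {x} r a∈A with a ∈? A
... | no a∉A = ⊥-elim (a∉A a∈A)
... | yes _ with subset-≟ A ⁅ a ⁆
...   | yes _ = sym (++-identityʳ x)
...   | no _ = refl

÷R≡cancelLast : ∀ {x} (r : Reverse x) → divR-view r a ≡ cancelLast x a
÷R≡cancelLast [] = refl
÷R≡cancelLast {a = a} (x ∶ r ∶ʳ A) = by-last-step (a ∈? A)
  where
  by-last-step : Dec (a ∈ A) → divR-view (x ∶ r ∶ʳ A) a ≡ cancelLast (x ++ [ A ]) a
  by-last-step (no a∉A) = trans (÷R-snoc-absent r a∉A)
    (trans (cong (_++ [ A ]) (÷R≡cancelLast r)) (sym (cancelLast-skip x [ A ] (¬Occurs-∷ a∉A ¬Occurs-[]))))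
  by-last-step (yes a∈A) = trans (÷R-snoc-present r a∈A)
    (sym (trans (cancelLast-within x [ A ] (here a∈A))
                (cong (x ++_) (trans (cancelLast-last {a = a} {A = A} ¬Occurs-[]) (++-identityʳ (cancel A a))))))

data AtMostOnce (a : Fin n) : List (Subset n) → Set where
  none  : AtMostOnce a []
  first : a ∈ A → ¬ Occurs a t → AtMostOnce a (A ∷ t)
  later : a ∉ A → AtMostOnce a t → AtMostOnce a (A ∷ t)

at-most-once-[_] : ∀ X → AtMostOnce a [ X ]
at-most-once-[_] {a = a} X with a ∈? X
... | yes a∈X = first a∈X ¬Occurs-[]
... | no a∉X = later a∉X none

at-most-once-pair : Disjoint X Y → AtMostOnce a (X ∷ Y ∷ [])
at-most-once-pair {X = X} {Y = Y} {a = a} disjoint with a ∈? X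
... | yes a∈X = first a∈X (¬Occurs-∷ (disjoint a∈X) ¬Occurs-[])
... | no a∉X = later a∉X at-most-once-[ Y ]

-- Steps, windows and the generic invariance principle

module _ {n : ℕ} (Σ : GComtraceAlphabet n) where
  open GComtraceAlphabet Σ

  private
    Step = IsStep Σ
    Seq = IsStepSeq Σ
    _≈_ = _≡gc_ Σ

  Serial : Subset n → Subset n → Set
  Serial B C = ∀ b c → b ∈ B → c ∈ C → ser b c

  Interleaved : Subset n → Subset n → Set
  Interleaved A B = ∀ x y → x ∈ A → y ∈ B → inl x y

  -- ser and inl are irreflexive, so the related steps are disjoint.
  serial-disjoint : Serial B C → Disjoint B C
  serial-disjoint serial {x} x∈B x∈C = sim-irrefl x (ser⊆sim x x (serial x x x∈B x∈C))

  interleaved-disjoint : Interleaved A B → Disjoint A B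
  interleaved-disjoint inl-AB {x} x∈A x∈B = inl-irrefl x (inl-AB x x x∈A x∈B)

  interleaved-sym : Interleaved A B → Interleaved B A
  interleaved-sym inl-AB x y x∈B y∈A = inl-sym y x (inl-AB y x y∈A x∈B)

  serial-mono : X ⊆ B → Y ⊆ C → Serial B C → Serial X Y
  serial-mono X⊆B Y⊆C serial x y x∈X y∈Y = serial x y (X⊆B x∈X) (Y⊆C y∈Y)

  interleaved-mono : X ⊆ A → Y ⊆ B → Interleaved A B → Interleaved X Y
  interleaved-mono X⊆A Y⊆B inl-AB x y x∈X y∈Y = inl-AB x y (X⊆A x∈X) (Y⊆B y∈Y)

  substep : Step A → X ⊆ A → X ≢ ⊥ → Step X
  substep (_ , simultaneous) X⊆A X≢⊥ =
    ≢⊥⇒nonempty X≢⊥ , λ x y x∈X y∈X → simultaneous x y (X⊆A x∈X) (X⊆A y∈X)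

  data Window : List (Subset n) → List (Subset n) → Set where
    ser-window : Step (B ∪ C) → Step B → Step C → Serial B C → Window [ B ∪ C ] (B ∷ C ∷ [])
    inl-window : Step A → Step B → Interleaved A B → Window (A ∷ B ∷ []) (B ∷ A ∷ [])

  window-seq : Window L R → Seq L × Seq R
  window-seq (ser-window sBC sB sC _) = sBC ∷ [] , sB ∷ sC ∷ []
  window-seq (inl-window sA sB _) = sA ∷ sB ∷ [] , sB ∷ sA ∷ []

  window-gen : Seq w → Seq z → Window L R → Gen Σ (w ++ L ++ z) (w ++ R ++ z)
  window-gen sw sz (ser-window sBC sB sC serial) = ser-split _ _ _ _ _ sw sz sBC sB sC refl serial
  window-gen sw sz (inl-window sA sB inl-AB) = inl-swap _ _ _ _ sw sz sA sB inl-AB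

  window-≈ : Window L R → L ≈ R
  window-≈ W@(ser-window _ _ _ _) = gc-gen (window-gen [] [] W)
  window-≈ W@(inl-window _ _ _) = gc-gen (window-gen [] [] W)

  gen-elim : ∀ {ℓ} (P : List (Subset n) → List (Subset n) → Set ℓ) →
             (∀ {w z L R} → Seq w → Seq z → Window L R → P (w ++ L ++ z) (w ++ R ++ z)) →
             Gen Σ x y → P x y
  gen-elim P windows (ser-split _ _ _ _ _ sw sz sBC sB sC refl serial) = windows sw sz (ser-window sBC sB sC serial)
  gen-elim P windows (inl-swap _ _ _ _ sw sz sA sB inl-AB) = windows sw sz (inl-window sA sB inl-AB)

  ≈-isEquivalence : IsEquivalence _≈_
  ≈-isEquivalence = record { refl = gc-refl ; sym = gc-sym ; trans = gc-trans }

  ≈-elim : ∀ {ℓ} (Rel′ : Rel (List (Subset n)) ℓ) → IsEquivalence Rel′ →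
           (∀ {x y} → Gen Σ x y → Rel′ x y) → x ≈ y → Rel′ x y
  ≈-elim Rel′ equiv gen gc-refl = IsEquivalence.refl equiv
  ≈-elim Rel′ equiv gen (gc-sym p) = IsEquivalence.sym equiv (≈-elim Rel′ equiv gen p)
  ≈-elim Rel′ equiv gen (gc-trans p q) = IsEquivalence.trans equiv (≈-elim Rel′ equiv gen p) (≈-elim Rel′ equiv gen q)
  ≈-elim Rel′ equiv gen (gc-gen g) = gen g

  invariant : ∀ {ℓ} {V : Set ℓ} (f : List (Subset n) → V) →
              (∀ {w z L R} → Seq w → Seq z → Window L R → f (w ++ L ++ z) ≡ f (w ++ R ++ z)) →
              x ≈ y → f x ≡ f y
  invariant f windows = ≈-elim (_≡_ on f) (On.isEquivalence f isEquivalence) (gen-elim (_≡_ on f) windows)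

  congruent : (f : List (Subset n) → List (Subset n)) →
              (∀ {w z L R} → Seq w → Seq z → Window L R → f (w ++ L ++ z) ≈ f (w ++ R ++ z)) →
              x ≈ y → f x ≈ f y
  congruent f windows = ≈-elim (_≈_ on f) (On.isEquivalence f ≈-isEquivalence) (gen-elim (_≈_ on f) windows)

  resp-≡ : u ≡ x → v ≡ y → x ≈ y → u ≈ v
  resp-≡ refl refl x≈y = x≈y

  ≈-context : Seq s → Seq t → x ≈ y → (s ++ x ++ t) ≈ (s ++ y ++ t)
  ≈-context {s = s} {t = t} ss st = congruent (λ x → s ++ x ++ t) in-context
    where
    regroup : ∀ w M z → s ++ (w ++ M ++ z) ++ t ≡ (s ++ w) ++ M ++ (z ++ t)
    regroup w M z = trans (cong (s ++_) (trans (++-assoc w (M ++ z) t) (cong (w ++_) (++-assoc M z t))))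
                          (sym (++-assoc s w (M ++ z ++ t)))
    in-context : ∀ {w z L R} → Seq w → Seq z → Window L R →
                 (s ++ (w ++ L ++ z) ++ t) ≈ (s ++ (w ++ R ++ z) ++ t)
    in-context {w} {z} {L} {R} sw sz W =
      resp-≡ (regroup w L z) (regroup w R z) (gc-gen (window-gen (All.++⁺ ss sw) (All.++⁺ sz st) W))

  -- (1) Splitting a step preserves its size (B, C are disjoint); swapping
  -- two steps preserves the sum of sizes.
  window-weight : Window L R → weight L ≡ weight R
  window-weight (ser-window {B = B} {C = C} _ _ _ serial) =
    trans (cong (_+ 0) (∣∪∣-disjoint B C (serial-disjoint serial))) (+-assoc ∣ B ∣ ∣ C ∣ 0)
  window-weight (inl-window {A = A} {B = B} _ _ _) = x∙yz≈y∙xz ∣ A ∣ ∣ B ∣ 0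

  weight-invariant : x ≈ y → weight x ≡ weight y
  weight-invariant = invariant weight in-context
    where
    split : ∀ w M z → weight (w ++ M ++ z) ≡ weight w + (weight M + weight z)
    split w M z = trans (weight-++ w (M ++ z)) (cong (weight w +_) (weight-++ M z))
    in-context : ∀ {w z L R} → Seq w → Seq z → Window L R → weight (w ++ L ++ z) ≡ weight (w ++ R ++ z)
    in-context {w} {z} {L} {R} _ _ W =
      trans (split w L z) (trans (cong (λ k → weight w + (k + weight z)) (window-weight W)) (sym (split w R z)))

  seq-π′ : ∀ D → Seq x → Seq (π′ D x)
  seq-π′ D [] = []
  seq-π′ D (_∷_ {x = A} sA sx) with subset-≟ (A ∩ D) ⊥
  ... | yes _ = seq-π′ D sx
  ... | no A∩D≢⊥ = substep sA (p∩q⊆p A D) A∩D≢⊥ ∷ seq-π′ D sx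

  -- Restricting the two halves of a serial split to subsets yields a serial
  -- split, or equal sequences once an empty half disappears.
  restricted-ser : Step (B ∪ C) → Step B → Step C → Serial B C → X ⊆ B → Y ⊆ C →
                   prepend (X ∪ Y) [] ≈ prepend X (prepend Y [])
  restricted-ser {X = X} {Y = Y} sBC sB sC serial X⊆B Y⊆C with subset-≟ X ⊥ | subset-≟ Y ⊥
  ... | yes refl | yes refl = resp-≡ (prepend-⊥ (∪-identityˡ ⊥)) refl gc-refl
  ... | yes refl | no Y≢⊥ = resp-≡ (trans (cong (λ S → prepend S []) (∪-identityˡ Y)) (prepend-≢⊥ Y≢⊥)) refl gc-refl
  ... | no X≢⊥ | yes refl = resp-≡ (trans (cong (λ S → prepend S []) (∪-identityʳ X)) (prepend-≢⊥ X≢⊥)) refl gc-refl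
  ... | no X≢⊥ | no Y≢⊥ = resp-≡ (prepend-≢⊥ X∪Y≢⊥) refl (window-≈
          (ser-window (substep sBC (∪-mono-⊆ X⊆B Y⊆C) X∪Y≢⊥) (substep sB X⊆B X≢⊥) (substep sC Y⊆C Y≢⊥)
                      (serial-mono X⊆B Y⊆C serial)))
    where
    X∪Y≢⊥ : X ∪ Y ≢ ⊥
    X∪Y≢⊥ = ⊆-≢⊥ (p⊆p∪q Y) X≢⊥

  restricted-inl : Step A → Step B → Interleaved A B → X ⊆ A → Y ⊆ B →
                   prepend X (prepend Y []) ≈ prepend Y (prepend X [])
  restricted-inl {X = X} {Y = Y} sA sB inl-AB X⊆A Y⊆B with subset-≟ X ⊥ | subset-≟ Y ⊥
  ... | yes _ | yes _ = gc-refl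
  ... | yes _ | no _ = gc-refl
  ... | no _ | yes _ = gc-refl
  ... | no X≢⊥ | no Y≢⊥ =
    window-≈ (inl-window (substep sA X⊆A X≢⊥) (substep sB Y⊆B Y≢⊥) (interleaved-mono X⊆A Y⊆B inl-AB))

  window-π : ∀ D → Window L R → π′ D L ≈ π′ D R
  window-π D (ser-window {B = B} {C = C} sBC sB sC serial) =
    resp-≡ (cong (λ S → prepend S []) (∩-distribʳ-∪ D B C)) refl
           (restricted-ser sBC sB sC serial (p∩q⊆p B D) (p∩q⊆p C D))
  window-π D (inl-window {A = A} {B = B} sA sB inl-AB) = restricted-inl sA sB inl-AB (p∩q⊆p A D) (p∩q⊆p B D)

  π′-congruent : ∀ D → x ≈ y → π′ D x ≈ π′ D y
  π′-congruent D = congruent (π′ D) in-context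
    where
    split : ∀ w M z → π′ D (w ++ M ++ z) ≡ π′ D w ++ π′ D M ++ π′ D z
    split w M z = trans (π′-++ D w (M ++ z)) (cong (π′ D w ++_) (π′-++ D M z))
    in-context : ∀ {w z L R} → Seq w → Seq z → Window L R → π′ D (w ++ L ++ z) ≈ π′ D (w ++ R ++ z)
    in-context {w} {z} {L} {R} sw sz W =
      resp-≡ (split w L z) (split w R z) (≈-context (seq-π′ D sw) (seq-π′ D sz) (window-π D W))

  π-congruent : ∀ D → x ≈ y → π D x ≈ π D y
  π-congruent {x = x} {y = y} D x≈y =
    resp-≡ (π≡π′ D (reverseView x)) (π≡π′ D (reverseView y)) (π′-congruent D x≈y)

  -- (2) Occurrences of a are the weight of the projection onto {a}.
  occ-invariant : ∀ a → x ≈ y → occ x a ≡ occ y a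
  occ-invariant {x = x} {y = y} a x≈y =
    trans (occ≡weight∘π′ x a) (trans (weight-invariant (π′-congruent ⁅ a ⁆ x≈y)) (sym (occ≡weight∘π′ y a)))

  seq-÷L : ∀ a → Seq x → Seq (x ÷L a)
  seq-÷L a [] = []
  seq-÷L a (_∷_ {x = A} sA sx) with a ∈? A
  ... | no _ = sA ∷ seq-÷L a sx
  ... | yes a∈A with subset-≟ A ⁅ a ⁆
  ...   | yes _ = sx
  ...   | no A≢⁅a⁆ = substep sA (p─q⊆p A ⁅ a ⁆) (λ rest≡⊥ → ∩∁⁅⁆-nonempty a∈A A≢⁅a⁆ (trans (sym (─≡∩∁ A ⁅ a ⁆)) rest≡⊥)) ∷ sx

  seq-cancelLast : ∀ a → Seq x → Seq (cancelLast x a)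
  seq-cancelLast a [] = []
  seq-cancelLast a (_∷_ {xs = w} sA sw) with occurs? a w
  ... | yes _ = sA ∷ seq-cancelLast a sw
  ... | no _ = All.++⁺ (seq-÷L a (sA ∷ [])) sw

  cancel-as-prepend : Step A → cancel A a ++ t ≡ prepend (A ∩ ∁ ⁅ a ⁆) t
  cancel-as-prepend {A = A} {a = a} {t = t} sA with a ∈? A
  ... | no a∉A = sym (trans (cong (λ S → prepend S t) (∩∁⁅⁆-absent a∉A)) (prepend-≢⊥ (nonempty⇒≢⊥ (proj₁ sA))))
  ... | yes a∈A with subset-≟ A ⁅ a ⁆
  ...   | yes refl = sym (prepend-⊥ (∩-inverseʳ ⁅ a ⁆))
  ...   | no A≢⁅a⁆ = sym (trans (prepend-≢⊥ (∩∁⁅⁆-nonempty a∈A A≢⁅a⁆)) (cong (_∷ t) (sym (─≡∩∁ A ⁅ a ⁆))))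

  π′-avoiding : ∀ a → Seq x → ¬ Occurs a x → π′ (∁ ⁅ a ⁆) x ≡ x
  π′-avoiding a [] _ = refl
  π′-avoiding a (sA ∷ sx) ¬occ =
    trans (sym (cancel-as-prepend sA)) (cong₂ _++_ (cancel-absent (λ a∈A → ¬occ (here a∈A))) (π′-avoiding a sx (λ occ → ¬occ (there occ))))

  restriction-last : Step A → Seq x → ¬ Occurs a x → cancel A a ++ x ≡ π′ (∁ ⁅ a ⁆) (A ∷ x)
  restriction-last {A = A} {a = a} sA sx ¬occ = trans (cong (cancel A a ++_) (sym (π′-avoiding a sx ¬occ))) (cancel-as-prepend sA)

  restriction-pass : Step A → a ∉ A → y ≡ π′ (∁ ⁅ a ⁆) x → A ∷ y ≡ π′ (∁ ⁅ a ⁆) (A ∷ x)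
  restriction-pass sA a∉A y≡π′x = trans (cong₂ _++_ (sym (cancel-absent a∉A)) y≡π′x) (cancel-as-prepend sA)

  ÷L-restricts : Seq x → AtMostOnce a x → x ÷L a ≡ π′ (∁ ⁅ a ⁆) x
  ÷L-restricts [] none = refl
  ÷L-restricts (_∷_ {xs = x} sA sx) (first a∈A ¬occ) = trans (÷L-head x a∈A) (restriction-last sA sx ¬occ)
  ÷L-restricts (_∷_ {xs = x} sA sx) (later a∉A once) = trans (÷L-pass x a∉A) (restriction-pass {x = x} sA a∉A (÷L-restricts sx once))

  cancelLast-restricts : Seq x → AtMostOnce a x → cancelLast x a ≡ π′ (∁ ⁅ a ⁆) x
  cancelLast-restricts [] none = refl
  cancelLast-restricts (sA ∷ sx) (first a∈A ¬occ) = trans (cancelLast-last ¬occ) (restriction-last sA sx ¬occ)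
  cancelLast-restricts {a = a} (_∷_ {xs = x} sA sx) (later a∉A once) with occurs? a x
  ... | yes _ = restriction-pass {x = x} sA a∉A (cancelLast-restricts sx once)
  ... | no ¬occ = restriction-last sA sx ¬occ

  window-at-most-once : Window L R → AtMostOnce a L × AtMostOnce a R
  window-at-most-once (ser-window {B = B} {C = C} _ _ _ serial) =
    at-most-once-[ B ∪ C ] , at-most-once-pair (serial-disjoint serial)
  window-at-most-once (inl-window _ _ inl-AB) =
    at-most-once-pair (interleaved-disjoint inl-AB) , at-most-once-pair (interleaved-disjoint (interleaved-sym inl-AB))

  window-occurs : Window L R → Occurs a L ⇔ Occurs a R
  window-occurs (ser-window {B = B} {C = C} _ _ _ _) = mk⇔ split join
    where
    split : Occurs a [ B ∪ C ] → Occurs a (B ∷ C ∷ [])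
    split (here a∈B∪C) = [ here , (λ a∈C → there (here a∈C)) ]′ (x∈p∪q⁻ B C a∈B∪C)
    join : Occurs a (B ∷ C ∷ []) → Occurs a [ B ∪ C ]
    join (here a∈B) = here (x∈p∪q⁺ (inj₁ a∈B))
    join (there (here a∈C)) = here (x∈p∪q⁺ (inj₂ a∈C))
  window-occurs (inl-window _ _ _) = mk⇔ swap swap
    where
    swap : Occurs a (X ∷ Y ∷ []) → Occurs a (Y ∷ X ∷ [])
    swap (here a∈X) = there (here a∈X)
    swap (there (here a∈Y)) = here a∈Y

  -- Hence cancelling inside a window is projecting it, and (6) applies.
  window-÷L : ∀ a → Window L R → (L ÷L a) ≈ (R ÷L a)
  window-÷L a W with window-seq W | window-at-most-once {a = a} W
  ... | sL , sR | onceL , onceR = resp-≡ (÷L-restricts sL onceL) (÷L-restricts sR onceR) (window-π (∁ ⁅ a ⁆) W)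

  window-cancelLast : ∀ a → Window L R → cancelLast L a ≈ cancelLast R a
  window-cancelLast a W with window-seq W | window-at-most-once {a = a} W
  ... | sL , sR | onceL , onceR =
    resp-≡ (cancelLast-restricts sL onceL) (cancelLast-restricts sR onceR) (window-π (∁ ⁅ a ⁆) W)

  -- (4) Left cancellation hits the context before the window, the window
  -- itself, or the context after it.
  ÷L-congruent : ∀ a → x ≈ y → (x ÷L a) ≈ (y ÷L a)
  ÷L-congruent a = congruent (_÷L a) in-context
    where
    in-context : ∀ {w z L R} → Seq w → Seq z → Window L R → ((w ++ L ++ z) ÷L a) ≈ ((w ++ R ++ z) ÷L a)
    in-context {w} {z} {L} {R} sw sz W with occurs? a w | occurs? a L
    ... | yes in-w | _ =
      resp-≡ (÷L-within w (L ++ z) in-w) (÷L-within w (R ++ z) in-w) (gc-gen (window-gen (seq-÷L a sw) sz W))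
    ... | no ¬in-w | yes in-L =
      resp-≡ (within L in-L) (within R (Equivalence.to (window-occurs W) in-L)) (≈-context sw sz (window-÷L a W))
      where
      within : ∀ M → Occurs a M → ((w ++ M ++ z) ÷L a) ≡ w ++ (M ÷L a) ++ z
      within M in-M = trans (÷L-skip w (M ++ z) ¬in-w) (cong (w ++_) (÷L-within M z in-M))
    ... | no ¬in-w | no ¬in-L =
      resp-≡ (after L ¬in-L) (after R (λ in-R → ¬in-L (Equivalence.from (window-occurs W) in-R)))
             (gc-gen (window-gen sw (seq-÷L a sz) W))
      where
      after : ∀ M → ¬ Occurs a M → ((w ++ M ++ z) ÷L a) ≡ w ++ M ++ (z ÷L a)
      after M ¬in-M = trans (÷L-skip w (M ++ z) ¬in-w) (cong (w ++_) (÷L-skip M z ¬in-M))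

  cancelLast-congruent : ∀ a → x ≈ y → cancelLast x a ≈ cancelLast y a
  cancelLast-congruent a = congruent (λ x → cancelLast x a) in-context
    where
    in-context : ∀ {w z L R} → Seq w → Seq z → Window L R → cancelLast (w ++ L ++ z) a ≈ cancelLast (w ++ R ++ z) a
    in-context {w} {z} {L} {R} sw sz W with occurs? a z | occurs? a L
    ... | yes in-z | _ = resp-≡ (after L) (after R) (gc-gen (window-gen sw (seq-cancelLast a sz) W))
      where
      after : ∀ M → cancelLast (w ++ M ++ z) a ≡ w ++ M ++ cancelLast z a
      after M = trans (cancelLast-within w (M ++ z) (Any.++⁺ʳ M in-z)) (cong (w ++_) (cancelLast-within M z in-z))
    ... | no ¬in-z | yes in-L =
      resp-≡ (within L in-L) (within R (Equivalence.to (window-occurs W) in-L)) (≈-context sw sz (window-cancelLast a W))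
      where
      within : ∀ M → Occurs a M → cancelLast (w ++ M ++ z) a ≡ w ++ cancelLast M a ++ z
      within M in-M = trans (cancelLast-within w (M ++ z) (Any.++⁺ˡ in-M)) (cong (w ++_) (cancelLast-skip M z ¬in-z))
    ... | no ¬in-z | no ¬in-L =
      resp-≡ (before L ¬in-L) (before R (λ in-R → ¬in-L (Equivalence.from (window-occurs W) in-R)))
             (gc-gen (window-gen (seq-cancelLast a sw) sz W))
      where
      before : ∀ M → ¬ Occurs a M → cancelLast (w ++ M ++ z) a ≡ cancelLast w a ++ M ++ z
      before M ¬in-M = cancelLast-skip w (M ++ z) (¬Occurs-++ M ¬in-M ¬in-z)

  ÷R-congruent : ∀ a → x ≈ y → (x ÷R a) ≈ (y ÷R a)
  ÷R-congruent {x = x} {y = y} a x≈y =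
    resp-≡ (÷R≡cancelLast (reverseView x)) (÷R≡cancelLast (reverseView y)) (cancelLast-congruent a x≈y)

proposition7p2 : ∀ {n} (Σ : GComtraceAlphabet n) (u v : List (Subset n)) (a : Fin n) (D : Subset n) →
    IsStepSeq Σ u → IsStepSeq Σ v →
    ((_≡gc_ Σ u v → weight u ≡ weight v)
    × (_≡gc_ Σ u v → occ u a ≡ occ v a)
    × (_≡gc_ Σ u v → _≡gc_ Σ (u ÷R a) (v ÷R a))
    × (_≡gc_ Σ u v → _≡gc_ Σ (u ÷L a) (v ÷L a))
    × (_≡gc_ Σ u v ⇔ (∀ s t → IsStepSeq Σ s → IsStepSeq Σ t → _≡gc_ Σ (s ++ u ++ t) (s ++ v ++ t)))
    × (_≡gc_ Σ u v → _≡gc_ Σ (π D u) (π D v)))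
proposition7p2 Σ u v a D _ _ =
    weight-invariant Σ
  , occ-invariant Σ a
  , ÷R-congruent Σ a
  , ÷L-congruent Σ a
  , mk⇔ (λ u≈v s t ss st → ≈-context Σ ss st u≈v) without-context
  , π-congruent Σ D
  where
  without-context : (∀ s t → IsStepSeq Σ s → IsStepSeq Σ t → _≡gc_ Σ (s ++ u ++ t) (s ++ v ++ t)) → _≡gc_ Σ u v
  without-context in-context = resp-≡ Σ (sym (++-identityʳ u)) (sym (++-identityʳ v)) (in-context [] [] [] [])
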